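{- Let $K_n$ be a complete graph on vertices $1,\dots,n$ with threshold function $t$ satisfying $t(i)\le t(i+1)$ for all $1\le i<n$, and let $k$ be the number of external influencers. Then $K_n$ has a pervading link set if and only if $t(i)\le i+k-1$ for all $1\le i\le n$.
   Context: A network is a finite simple undirected graph with threshold function $t:V\to\mathbb{Z}^+$. Let $U=\{\mu_1,\dots,\mu_k\}$ be $k$ external influencers, active from the start. A link set is a set $S\subseteq U\times V$; $s(v)$ is the number of links of $S$ incident to $v$. The diffusion process is defined as follows, where $\Gamma(v)$ is the neighbourhood of $v$. At step $0$ the active set is $A_0=\{v: s(v)\ge t(v)\}$. At step $j\ge1$ the active set is $A_j=A_{j-1}\cup\{v: |\Gamma(v)\cap A_{j-1}|\ge t(v)-s(v)\}$. Active nodes remain active. $S$ is pervading if eventually all nodes are active. -}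

module Defs where

open import Data.Nat using (ℕ; zero; suc; _+_; _∸_; _≤_; _≤ᵇ_)
open import Data.Fin using (Fin; zero; suc; toℕ; _≟_)
open import Data.Bool using (Bool; true; false; if_then_else_; _∧_; _∨_; not)
open import Data.Product using (∃)
open import Relation.Nullary.Decidable using (⌊_⌋)

count : ∀ {n} → (Fin n → Bool) → ℕ
count {zero}  p = 0
count {suc n} p = (if p zero then 1 else 0) + count (λ i → p (suc i))

-- A link set S ⊆ U × V, with U = Fin k (influencers) and V = Fin n (vertices),
-- given by its (Boolean) indicator function.
LinkSet : ℕ → ℕ → Set
LinkSet k n = Fin k → Fin n → Bool

links : ∀ {k n} → LinkSet k n → Fin n → ℕ
links S v = count (λ μ → S μ v)

adjK : ∀ {n} → Fin n → Fin n → Bool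
adjK u v = not ⌊ u ≟ v ⌋

active : ∀ {k n} → (Fin n → ℕ) → LinkSet k n → ℕ → Fin n → Bool
active t S zero v = t v ≤ᵇ links S v
active t S (suc j) v =
  active t S j v ∨ ((t v ∸ links S v) ≤ᵇ count (λ u → adjK u v ∧ active t S j u))

Pervading : ∀ {k n} → (Fin n → ℕ) → LinkSet k n → Set
Pervading {k} {n} t S = ∃ λ j → ∀ (v : Fin n) → active t S j v ≡ true
  where open import Relation.Binary.PropositionalEquality using (_≡_)

-- If t(i) ≤ i + k for every vertex (indexed from 0), linking every influencer to every vertex
-- activates vertex i by step i, since its i predecessors are then active neighbours.
-- Conversely, if t(i) > i + k for some i, monotonicity gives t(v) > i + k for every v ≥ i;
-- such a vertex has at most k links and at most i neighbours outside {v ≥ i}, so by induction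
-- on the step no vertex of {v ≥ i} ever becomes active.
module Submission where

open import Defs
open import Data.Nat using (ℕ; zero; suc; _+_; _∸_; _⊓_; _≤_; _<_; _<ᵇ_; z≤n; s≤s; s≤s⁻¹)
open import Data.Nat.Properties
  using ( ≤-refl; ≤-trans; ≤-<-trans; ≤-reflexive; <⇒≤; ≰⇒>; ≮⇒≥; <⇒≱; <-irrefl; m≤n⇒m≤1+n
        ; +-mono-≤; m≤n+o⇒m∸n≤o; m+n≤o⇒m≤o∸n; m⊓n≤m; m≤n⇒m⊓n≡m; ⊓-zeroʳ
        ; ≤ᵇ⇒≤; ≤⇒≤ᵇ; <ᵇ⇒<; <⇒<ᵇ; n≤0⇒n≡0; +-comm; m≤n+m; module ≤-Reasoning )
open import Data.Fin using (Fin; zero; suc; toℕ)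
open import Data.Fin.Properties using (toℕ<n)
open import Data.Bool using (Bool; true; false; T; _∧_)
open import Data.Bool.Properties using (T-≡; T-∧; T-∨)
open import Data.Product using (∃; _,_; proj₂)
open import Data.Empty using (⊥-elim)
open import Data.Sum using ([_,_]; inj₂)
open import Relation.Nullary using (¬_)
open import Relation.Nullary.Decidable using (fromWitnessFalse)
open import Relation.Binary.PropositionalEquality using (_≡_; refl; sym; cong; subst)
open import Function.Base using (_∘_)
open import Function.Bundles using (_⇔_; mk⇔; Equivalence)

open Equivalence using (to; from)

count-mono : ∀ {n} {p q : Fin n → Bool} → (∀ u → T (p u) → T (q u)) → count p ≤ count q
count-mono {zero}          p⇒q = z≤n
count-mono {suc n} {p} {q} p⇒q with p zero | q zero | p⇒q zero
... | false | false | _  = count-mono (λ u → p⇒q (suc u))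
... | false | true  | _  = m≤n⇒m≤1+n (count-mono (λ u → p⇒q (suc u)))
... | true  | true  | _  = s≤s (count-mono (λ u → p⇒q (suc u)))
... | true  | false | p⇒q₀ = ⊥-elim (p⇒q₀ _)

count-true : ∀ n → count {n} (λ _ → true) ≡ n
count-true zero    = refl
count-true (suc n) = cong suc (count-true n)

count-≤ : ∀ {n} (p : Fin n → Bool) → count p ≤ n
count-≤ {n} p = subst (count p ≤_) (count-true n) (count-mono {p = p} {q = λ _ → true} (λ _ _ → _))

-- x <ᵇ 0 reduces to false for every x, so the case m = 0 is a plain recursive call.
count-below : ∀ n m → count {n} (λ u → toℕ u <ᵇ m) ≡ m ⊓ n
count-below zero    m       = sym (⊓-zeroʳ m)
count-below (suc n) zero    = count-below n zero
count-below (suc n) (suc m) = cong suc (count-below n m)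

count-≤-bound : ∀ {n} m (p : Fin n → Bool) → (∀ u → T (p u) → toℕ u < m) → count p ≤ m
count-≤-bound {n} m p p⇒below = begin
  count p                       ≤⟨ count-mono {q = λ u → toℕ u <ᵇ m} (λ u pu → <⇒<ᵇ (p⇒below u pu)) ⟩
  count {n} (λ u → toℕ u <ᵇ m)  ≡⟨ count-below n m ⟩
  m ⊓ n                         ≤⟨ m⊓n≤m m n ⟩
  m                             ∎
  where open ≤-Reasoning

count-≥-bound : ∀ {n} m (p : Fin n → Bool) → m ≤ n → (∀ u → toℕ u < m → T (p u)) → m ≤ count p
count-≥-bound {n} m p m≤n below⇒p = begin
  m                             ≡⟨ sym (m≤n⇒m⊓n≡m m≤n) ⟩
  m ⊓ n                         ≡⟨ sym (count-below n m) ⟩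
  count {n} (λ u → toℕ u <ᵇ m)  ≤⟨ count-mono {p = λ u → toℕ u <ᵇ m} (λ u below → below⇒p u (<ᵇ⇒< (toℕ u) m below)) ⟩
  count p                       ∎
  where open ≤-Reasoning

StepwiseMonotone : ∀ {n} → (Fin n → ℕ) → Set
StepwiseMonotone t = ∀ i j → toℕ j ≡ suc (toℕ i) → t i ≤ t j

StepwiseMonotone-suc : ∀ {n} {t : Fin (suc n) → ℕ} → StepwiseMonotone t → StepwiseMonotone (t ∘ suc)
StepwiseMonotone-suc step i j j≡1+i = step (suc i) (suc j) (cong suc j≡1+i)

stepwise-mono⇒mono : ∀ {n} {t : Fin n → ℕ} → StepwiseMonotone t → ∀ i j → toℕ i ≤ toℕ j → t i ≤ t j
stepwise-mono⇒mono step zero    zero          _         = ≤-refl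
stepwise-mono⇒mono step zero    (suc zero)    _         = step zero (suc zero) refl
stepwise-mono⇒mono step zero    (suc (suc j)) _         =
  ≤-trans (step zero (suc zero) refl) (stepwise-mono⇒mono (StepwiseMonotone-suc step) zero (suc j) z≤n)
stepwise-mono⇒mono step (suc i) (suc j)       (s≤s i≤j) = stepwise-mono⇒mono (StepwiseMonotone-suc step) i j i≤j

adjK-< : ∀ {n} {u v : Fin n} → toℕ u < toℕ v → T (adjK u v)
adjK-< u<v = fromWitnessFalse (λ u≡v → <-irrefl (cong toℕ u≡v) u<v)

completeLinks : ∀ {k n} → LinkSet k n
completeLinks _ _ = true

links-completeLinks : ∀ {k n} (v : Fin n) → links (completeLinks {k}) v ≡ k
links-completeLinks {k} _ = count-true k

completeLinks-activates-prefix : ∀ {k n} (t : Fin n → ℕ) → (∀ i → t i ≤ toℕ i + k)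
  → ∀ j (v : Fin n) → toℕ v ≤ j → T (active t (completeLinks {k}) j v)
completeLinks-activates-prefix {k} t t≤i+k zero v v≤0 = ≤⇒≤ᵇ (begin
  t v                           ≤⟨ t≤i+k v ⟩
  toℕ v + k                     ≡⟨ cong (_+ k) (n≤0⇒n≡0 v≤0) ⟩
  k                             ≡⟨ sym (links-completeLinks {k} v) ⟩
  links (completeLinks {k}) v   ∎)
  where open ≤-Reasoning
completeLinks-activates-prefix {k} t t≤i+k (suc j) v v≤1+j = from T-∨ (inj₂ (≤⇒≤ᵇ (begin
  t v ∸ links (completeLinks {k}) v ≡⟨ cong (t v ∸_) (links-completeLinks {k} v) ⟩
  t v ∸ k                       ≤⟨ m≤n+o⇒m∸n≤o (t v) k (≤-trans (t≤i+k v) (≤-reflexive (+-comm (toℕ v) k))) ⟩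
  toℕ v                         ≤⟨ active-predecessors ⟩
  count (λ u → adjK u v ∧ active t (completeLinks {k}) j u) ∎)))
  where
  open ≤-Reasoning
  active-predecessors : toℕ v ≤ count (λ u → adjK u v ∧ active t (completeLinks {k}) j u)
  active-predecessors = count-≥-bound (toℕ v) _ (<⇒≤ (toℕ<n v)) λ u u<v →
    from T-∧ (adjK-< u<v , completeLinks-activates-prefix t t≤i+k j u (s≤s⁻¹ (≤-trans u<v v≤1+j)))

below-threshold : ∀ {c m s k t} → c ≤ m → s ≤ k → m + k < t → c < t ∸ s
below-threshold {c} c≤m s≤k m+k<t = m+n≤o⇒m≤o∸n (suc c) (≤-trans (+-mono-≤ (s≤s c≤m) s≤k) m+k<t)

suffix-never-active : ∀ {k n} (t : Fin n → ℕ) (S : LinkSet k n) m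
  → (∀ v → m ≤ toℕ v → m + k < t v)
  → ∀ j (v : Fin n) → m ≤ toℕ v → ¬ T (active t S j v)
suffix-never-active {k} t S m high zero v m≤v fires =
  <⇒≱ (≤-<-trans (≤-trans (count-≤ (λ μ → S μ v)) (m≤n+m k m)) (high v m≤v)) (≤ᵇ⇒≤ _ _ fires)
suffix-never-active {k} t S m high (suc j) v m≤v fires =
  [ suffix-never-active t S m high j v m≤v
  , (λ supported → <⇒≱ (below-threshold active-neighbours≤m (count-≤ (λ μ → S μ v)) (high v m≤v))
                      (≤ᵇ⇒≤ _ _ supported)) ] (to T-∨ fires)
  where
  active-neighbours≤m : count (λ u → adjK u v ∧ active t S j u) ≤ m
  active-neighbours≤m = count-≤-bound m _ λ u adj∧active →
    ≰⇒> λ m≤u → suffix-never-active t S m high j u m≤u (proj₂ (to T-∧ adj∧active))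

mainTheorem8 : (n k : ℕ) (t : Fin n → ℕ)
    → (∀ (v : Fin n) → 1 ≤ t v)
    → (∀ (i j : Fin n) → toℕ j ≡ suc (toℕ i) → t i ≤ t j)
    → (∃ λ (S : LinkSet k n) → Pervading t S)
      ⇔ (∀ (i : Fin n) → t i ≤ toℕ i + k)
mainTheorem8 n k t _ step = mk⇔ necessary sufficient
  where
  necessary : (∃ λ (S : LinkSet k n) → Pervading t S) → ∀ i → t i ≤ toℕ i + k
  necessary (S , j , all-active) i = ≮⇒≥ λ i+k<t →
    suffix-never-active t S (toℕ i) (λ v i≤v → ≤-trans i+k<t (stepwise-mono⇒mono step i v i≤v))
      j i ≤-refl (from T-≡ (all-active i))

  sufficient : (∀ i → t i ≤ toℕ i + k) → ∃ λ (S : LinkSet k n) → Pervading t S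
  sufficient t≤i+k = completeLinks , n , λ v →
    to T-≡ (completeLinks-activates-prefix t t≤i+k n v (<⇒≤ (toℕ<n v)))
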